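{- For every integer $m \ge 1$ there exists a PCFP $\mathfrak{P}$ having a location $l$ without self-loops and a location $l' \neq l$ with an ingoing transition $l' \to l$ of multiplicity $m$, such that the following holds. Let $\mathfrak{P}'$ be the result of applying to $l$ the algorithm "while there exists a transition $l'' \xrightarrow{\varphi \to p : u} l$, eliminate that transition", and let $\widetilde{\mathfrak{P}}$ be any PCFP obtained from $\mathfrak{P}$ by eliminating $l$ with any other technique (i.e., transitions leading to $l$ are replaced by transitions to the successors of $l$) such that $\mathcal{M}_{\widetilde{\mathfrak{P}}} = \mathcal{M}_{\mathfrak{P}'}$. Then $\widetilde{\mathfrak{P}}$ has at least $2^m$ commands at location $l'$.
   Context: Variables and updates: $\mathsf{Var}$ is a finite set of integer variables; an update $u=[x_1'=f_1,\dots,x_n'=f_n]$ executes integer-valued assignments simultaneously, mapping valuation $\nu$ to $u(\nu)$; $u_1;u_2$ is the chained update. A command has the form $l,\varphi\to p_1:u_1:l_1+\dots+p_k:u_k:l_k$ with locations $l,l_i$, guard $\varphi$ (Boolean expression over $\mathsf{Var}$), updates $u_i$, and constant real probabilities $p_i\ge0$ summing to 1; each summand is a transition $l\xrightarrow{\varphi\to p_i:u_i}l_i$. The multiplicity of a transition $l'\xrightarrow{\varphi\to p:u}l$ contained in command $\gamma$ is the total number of transitions in $\gamma$ with destination $l$. A location has a self-loop if it has a transition to itself. A PCFP $\mathfrak{P}=(\mathsf{Loc},\mathsf{Var},\mathsf{dom},\mathsf{Cmd},\iota)$ has finite nonempty $\mathsf{Loc}$, finite domains $\mathsf{dom}(x)\subseteq\mathbb{Z}$,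 command set $\mathsf{Cmd}$, initial pair $\iota=(l_\iota,\nu_\iota)$. Semantic MDP $\mathcal{M}_{\mathfrak{P}}$: states $\mathsf{Loc}\times\{\nu\in\mathsf{dom}\}\cup\{\bot\}$, initial state $\langle l_\iota,\nu_\iota\rangle$, one action $a_\gamma$ per command; for transition $l\xrightarrow{\varphi\to p:u}l'$ of $\gamma$ and $\nu\in\mathsf{dom}$, $\nu\models\varphi$: $\langle l,\nu\rangle\xrightarrow{a_\gamma,p}\langle l',u(\nu)\rangle$ if $u(\nu)\in\mathsf{dom}$, else to $\bot$. Weakest precondition: $\wp([x_1'=f_1,\dots,x_n'=f_n],\psi)=\psi[x_1/f_1]\dots[x_n/f_n]$, $\wp(u_1;u_2,\psi)=\wp(u_1,\wp(u_2,\psi))$. Transition elimination of $\hat l\xrightarrow{\varphi\to p:u}l_1$, belonging to command $\gamma:\ \hat l,\varphi\to p:u:l_1+\sum_{j=1}^n p_j:u_j:l_j$, where $l_1,\psi_i\to\sum_{j=1}^{m_i}q_{ij}:v_{ij}:l_{ij}$ ($i=1,\dots,m'$) are all commands at $l_1$: remove $\gamma$ and add for each $i$ the command $\hat l,\ \varphi\wedge\wp(u,\psi_i)\to\sum_{j=1}^n p_j:u_j:l_j+\sum_{j=1}^{m_i}p\,q_{ij}:(u;v_{ij}):l_{ij}$.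
   Formalization: The probabilities $p_i$ in commands are rational rather than real, also in every PCFP $\widetilde{\mathfrak{P}}$ obtained by eliminating $l$. -}

module Defs where

open import Data.Nat using (ℕ; _≥_; _≤_; _^_)
open import Data.Fin using (Fin; _≟_)
open import Data.Integer using (ℤ)
import Data.Integer as ℤ
open import Data.Rational using (ℚ; 0ℚ; 1ℚ; _+_; _*_)
import Data.Rational as ℚ
open import Data.Vec using (Vec; zipWith)
import Data.Vec as Vec
import Data.Vec.Properties as VecP
open import Data.List using (List; []; _∷_; _++_; map; filter; length; foldr)
open import Data.Bool.ListAction using (any; and)
open import Data.List.Membership.Propositional using (_∈_)
open import Data.List.Relation.Unary.Unique.Propositional using (Unique)
open import Data.Bool using (Bool; true; false; _∧_; if_then_else_)
open import Data.Maybe using (Maybe; just; nothing)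
import Data.Maybe.Properties as MaybeP
open import Data.Product using (Σ; _×_; _,_; Σ-syntax)
import Data.Product.Properties as ProdP
open import Relation.Nullary using (does; ¬_)
open import Relation.Binary using (DecidableEquality)
open import Relation.Binary.PropositionalEquality using (_≡_; _≢_)
open import Function using (_∘_)

Valuation : ℕ → Set
Valuation k = Vec ℤ k

Guard : ℕ → Set
Guard k = Valuation k → Bool

Update : ℕ → Set
Update k = Valuation k → Valuation k

_⨾_ : ∀ {k} → Update k → Update k → Update k
(u₁ ⨾ u₂) ν = u₂ (u₁ ν)

wp : ∀ {k} → Update k → Guard k → Guard k
wp u ψ = ψ ∘ u

record Branch (n k : ℕ) : Set where
  constructor br
  field
    prob : ℚ
    upd  : Update k
    dest : Fin n
open Branch public

record Command (n k : ℕ) : Set where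
  constructor cmd
  field
    src      : Fin n
    guard    : Guard k
    branches : List (Branch n k)
open Command public

record PCFP (n k : ℕ) : Set where
  field
    dom     : Vec (List ℤ) k
    cmds    : List (Command n k)
    initLoc : Fin n
    initVal : Valuation k
open PCFP public

sumℚ : List ℚ → ℚ
sumℚ = foldr _+_ 0ℚ

inDom : ∀ {k} → Vec (List ℤ) k → Valuation k → Bool
inDom D ν = and (Vec.toList (zipWith (λ z zs → any (λ w → does (z ℤ.≟ w)) zs) ν D))

WFCommand : ∀ {n k} → Command n k → Set
WFCommand c = ((b : Branch _ _) → b ∈ branches c → 0ℚ ℚ.≤ prob b)
            × sumℚ (map prob (branches c)) ≡ 1ℚ

WF : ∀ {n k} → PCFP n k → Set
WF P = ((c : Command _ _) → c ∈ cmds P → WFCommand c) × inDom (dom P) (initVal P) ≡ true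

cmdsAt : ∀ {n k} → Fin n → List (Command n k) → List (Command n k)
cmdsAt l = filter (λ c → src c ≟ l)

branchesTo : ∀ {n k} → Fin n → List (Branch n k) → List (Branch n k)
branchesTo l = filter (λ b → dest b ≟ l)

NoSelfLoop : ∀ {n k} → PCFP n k → Fin n → Set
NoSelfLoop P l = (c : Command _ _) → c ∈ cmds P → src c ≡ l →
                 (b : Branch _ _) → b ∈ branches c → dest b ≢ l

NoTransInto : ∀ {n k} → Fin n → List (Command n k) → Set
NoTransInto l cs = (c : Command _ _) → c ∈ cs → (b : Branch _ _) → b ∈ branches c → dest b ≢ l

HasTransMult : ∀ {n k} → PCFP n k → Fin n → Fin n → ℕ → Set
HasTransMult P l' l m = Σ[ γ ∈ Command _ _ ] (γ ∈ cmds P × src γ ≡ l' ×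
                          (Σ[ b ∈ Branch _ _ ] (b ∈ branches γ × dest b ≡ l)) ×
                          length (branchesTo l (branches γ)) ≡ m)

elimCmd : ∀ {n k} → Command n k → List (Branch n k) → Branch n k → Command n k → Command n k
elimCmd γ rest b c =
  cmd (src γ) (λ ν → guard γ ν ∧ wp (upd b) (guard c) ν)
      (rest ++ map (λ d → br (prob b * prob d) (upd b ⨾ upd d) (dest d)) (branches c))

data ElimStep {n k} (l : Fin n) : List (Command n k) → List (Command n k) → Set where
  elim : ∀ cs₁ cs₂ (γ : Command n k) bs₁ (b : Branch n k) bs₂ →
         branches γ ≡ bs₁ ++ b ∷ bs₂ → dest b ≡ l →
         ElimStep l (cs₁ ++ γ ∷ cs₂)
                    (cs₁ ++ cs₂ ++ map (elimCmd γ (bs₁ ++ bs₂) b) (cmdsAt l (cs₁ ++ γ ∷ cs₂)))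

data ElimLoc {n k} (l : Fin n) : List (Command n k) → List (Command n k) → Set where
  done : ∀ {cs} → NoTransInto l cs → ElimLoc l cs cs
  step : ∀ {cs cs' cs''} → ElimStep l cs cs' → ElimLoc l cs' cs'' → ElimLoc l cs cs''

-- states: just ⟨l , ν⟩ (with ν ∈ dom) or nothing = ⊥
State : ℕ → ℕ → Set
State n k = Maybe (Fin n × Valuation k)

_≟S_ : ∀ {n k} → DecidableEquality (State n k)
_≟S_ = MaybeP.≡-dec (ProdP.≡-dec _≟_ (VecP.≡-dec ℤ._≟_))

target : ∀ {n k} → Vec (List ℤ) k → Branch n k → Valuation k → State n k
target D b ν = if inDom D (upd b ν) then just (dest b , upd b ν) else nothing

dist : ∀ {n k} → Vec (List ℤ) k → Command n k → Valuation k → State n k → ℚ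
dist D c ν s = sumℚ (map (λ b → if does (target D b ν ≟S s) then prob b else 0ℚ) (branches c))

ActionsIncluded : ∀ {n k} → PCFP n k → PCFP n k → Set
ActionsIncluded P Q =
  (l : Fin _) (ν : Valuation _) → inDom (dom P) ν ≡ true →
  (c : Command _ _) → c ∈ cmds P → src c ≡ l → guard c ν ≡ true →
  Σ[ c' ∈ Command _ _ ] (c' ∈ cmds Q × src c' ≡ l × guard c' ν ≡ true ×
     ((s : State _ _) → dist (dom P) c ν s ≡ dist (dom Q) c' ν s))

-- M_P = M_Q (same states, same initial state, same transitions up to the
-- naming of actions)
SameMDP : ∀ {n k} → PCFP n k → PCFP n k → Set
SameMDP P Q = dom P ≡ dom Q × initLoc P ≡ initLoc Q × initVal P ≡ initVal Q
            × ActionsIncluded P Q × ActionsIncluded Q P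

withCmds : ∀ {n k} → PCFP n k → List (Command n k) → PCFP n k
withCmds P cs = record P { cmds = cs }

{-# OPTIONS --safe #-}
-- The witness has one variable x, locations l₀ and l₁, and two sinks.  At l₀ a single command,
-- the fan, takes m transitions into l₁, the j-th one setting x := j; at l₁ two commands lead to
-- the two sinks.  Eliminating a transition of a command at l₀ splits it into two, one per command
-- at l₁, so every run of the algorithm ends with, for each of the 2^m ways S of choosing a command
-- at l₁ per transition, a command at l₀ that sends x = j to sink S j with positive probability and
-- to the other sink never.  Since x records j, these 2^m commands have pairwise different
-- distributions at the initial state, so a program with the same MDP needs 2^m commands at l₀.
module Submission where

open import Defs
open import Data.Nat using (ℕ; zero; suc; _≥_; _≤_; _^_)
open import Data.Fin using (Fin; zero; suc; toℕ; _≟_)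
import Data.Fin.Properties as FinP
open import Data.Integer using (ℤ)
import Data.Integer as ℤ
import Data.Integer.Properties as ℤP
open import Data.Rational using (ℚ; 0ℚ; 1ℚ; ½; _+_; _*_)
import Data.Rational as ℚ
import Data.Rational.Properties as ℚP
open import Data.Vec using (Vec; lookup)
import Data.Vec as Vec
import Data.Vec.Properties as VecP
open import Data.Vec.Relation.Binary.Pointwise.Extensional using (ext; Pointwise-≡⇒≡)
import Data.Vec.Recursive as Rec
open import Data.Vec.Recursive.Properties using (↔Vec)
open import Data.List using (List; []; _∷_; _++_; map; tabulate; length)
import Data.List.Properties as LP
open import Data.List.Relation.Unary.All as All using (All; []; _∷_)
import Data.List.Relation.Unary.All.Properties as AllP
open import Data.List.Relation.Unary.Any as Any using (Any; here; there)
import Data.List.Relation.Unary.Any.Properties as AnyP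
open import Data.List.Membership.Propositional using (_∈_; find)
open import Data.List.Membership.Propositional.Properties
  using (∈-insert; ∈-++⁺ˡ; ∈-++⁺ʳ; ∈-map⁺; ∈-filter⁺; ∈-tabulate⁺)
import Data.List.Membership.Setoid.Properties as Membershipₛ
open import Data.List.Relation.Unary.Unique.Propositional using (Unique)
open import Data.Bool using (Bool; true; false; T; if_then_else_)
import Data.Bool.Properties as BP
open import Data.Bool.ListAction using (any)
open import Data.Maybe using (just)
import Data.Maybe.Properties as MaybeP
open import Data.Product using (_×_; _,_; proj₁; Σ-syntax; ∃-syntax)
import Data.Product.Properties as ProdP
open import Data.Sum using (_⊎_; inj₁; inj₂)
open import Data.Empty using (⊥-elim)
open import Function using (_∘_; Injective; Inverse; Equivalence)
open import Function.Properties.Inverse using (↔-trans)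
open import Relation.Binary.Construct.Closure.ReflexiveTransitive using (Star; ε; _◅_; _◅◅_)
open import Relation.Nullary using (yes; no; does)
open import Relation.Nullary.Decidable using (dec-true)
open import Relation.Binary.PropositionalEquality
  using (_≡_; _≢_; refl; sym; trans; cong; subst; setoid; module ≡-Reasoning)
open ≡-Reasoning

sumℚ-nonneg : ∀ {qs} → All (0ℚ ℚ.≤_) qs → 0ℚ ℚ.≤ sumℚ qs
sumℚ-nonneg []            = ℚP.≤-refl
sumℚ-nonneg (q≥0 ∷ qs≥0) = ℚP.+-mono-≤ q≥0 (sumℚ-nonneg qs≥0)

sumℚ-pos : ∀ {qs q} → All (0ℚ ℚ.≤_) qs → q ∈ qs → 0ℚ ℚ.< q → 0ℚ ℚ.< sumℚ qs
sumℚ-pos (_ ∷ qs≥0)   (here refl) q>0 = ℚP.+-mono-<-≤ q>0 (sumℚ-nonneg qs≥0)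
sumℚ-pos (q≥0 ∷ qs≥0) (there q∈qs) q>0 = ℚP.+-mono-≤-< q≥0 (sumℚ-pos qs≥0 q∈qs q>0)

sumℚ-zero : ∀ {qs} → All (_≡ 0ℚ) qs → sumℚ qs ≡ 0ℚ
sumℚ-zero []             = refl
sumℚ-zero (refl ∷ qs≡0) = cong (0ℚ +_) (sumℚ-zero qs≡0)

sumℚ-*ˡ : ∀ p qs → sumℚ (map (p *_) qs) ≡ p * sumℚ qs
sumℚ-*ˡ p []       = sym (ℚP.*-zeroʳ p)
sumℚ-*ˡ p (q ∷ qs) = trans (cong (p * q +_) (sumℚ-*ˡ p qs)) (sym (ℚP.*-distribˡ-+ p q (sumℚ qs)))

halves : (m : ℕ) → Fin (suc m) → ℚ
halves zero    _       = 1ℚ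
halves (suc m) zero    = ½
halves (suc m) (suc j) = ½ * halves m j

halves-pos : ∀ m j → 0ℚ ℚ.< halves m j
halves-pos zero    _       = ℚP.positive⁻¹ 1ℚ
halves-pos (suc m) zero    = ℚP.positive⁻¹ ½
halves-pos (suc m) (suc j) = ℚP.*-monoʳ-<-pos ½ (halves-pos m j)

halves-sum : ∀ m → sumℚ (tabulate (halves m)) ≡ 1ℚ
halves-sum zero    = refl
halves-sum (suc m) = begin
  ½ + sumℚ (tabulate (λ j → ½ * halves m j))  ≡⟨ cong (λ qs → ½ + sumℚ qs) (LP.map-tabulate (halves m) (½ *_)) ⟨
  ½ + sumℚ (map (½ *_) (tabulate (halves m))) ≡⟨ cong (½ +_) (sumℚ-*ˡ ½ (tabulate (halves m))) ⟩
  ½ + ½ * sumℚ (tabulate (halves m))          ≡⟨ cong (λ q → ½ + ½ * q) (halves-sum m) ⟩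
  1ℚ                                          ∎

injective⇒≤length : ∀ {A : Set} {m} {ys : List A} (f : Fin m → A) →
                    Injective _≡_ _≡_ f → (∀ i → f i ∈ ys) → m ≤ length ys
injective⇒≤length {A} f f-inj f∈ys =
  FinP.injective⇒≤ λ {i} {j} same-index →
    f-inj (Membershipₛ.index-injective (setoid A) (f∈ys i) (f∈ys j) same-index)

injective⇒^≤length : ∀ {A : Set} {k m} {ys : List A} (F : Vec (Fin k) m → A) →
                     Injective _≡_ _≡_ F → (∀ v → F v ∈ ys) → k ^ m ≤ length ys
injective⇒^≤length {k = k} {m} F F-inj F∈ys =
  injective⇒≤length (F ∘ to) (to-injective ∘ F-inj) (F∈ys ∘ to)
  where
  open Inverse (↔-trans (Rec.Fin[m^n]↔Fin[m]^n k m) (↔Vec m))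
  to-injective : Injective _≡_ _≡_ to
  to-injective {i} {j} eq = begin
    i           ≡⟨ strictlyInverseʳ i ⟨
    from (to i) ≡⟨ cong from eq ⟩
    from (to j) ≡⟨ strictlyInverseʳ j ⟩
    j           ∎

All-remove : ∀ {A : Set} {P : A → Set} xs {y ys} → All P (xs ++ y ∷ ys) → All P (xs ++ ys)
All-remove xs ps with AllP.++⁻ xs ps
... | pxs , _ ∷ pys = AllP.++⁺ pxs pys

Any-remove : ∀ {A : Set} {P : A → Set} xs {y ys} → Any P (xs ++ y ∷ ys) → P y ⊎ Any P (xs ++ ys)
Any-remove xs p with AnyP.++⁻ xs p
... | inj₁ p-xs         = inj₂ (AnyP.++⁺ˡ p-xs)
... | inj₂ (here py)    = inj₁ py
... | inj₂ (there p-ys) = inj₂ (AnyP.++⁺ʳ xs p-ys)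

∈-remove-++ : ∀ {A : Set} xs {y ys} zs {x : A} → x ∈ xs ++ y ∷ ys → x ≡ y ⊎ x ∈ xs ++ ys ++ zs
∈-remove-++ xs {ys = ys} zs x∈ with Any-remove xs x∈
... | inj₁ x≡y   = inj₁ x≡y
... | inj₂ x∈xys = inj₂ (subst (_ ∈_) (LP.++-assoc xs ys zs) (∈-++⁺ˡ x∈xys))

module _ {n k : ℕ} {l : Fin n} where

  NotAt : Command n k → Set
  NotAt c = src c ≢ l

  NoBranchInto : Command n k → Set
  NoBranchInto c = All (λ b → dest b ≢ l) (branches c)

  data LeadingInto : ℕ → List (Branch n k) → Set where
    []  : ∀ {bs} → All (λ b → dest b ≢ l) bs → LeadingInto zero bs
    _∷_ : ∀ {i b bs} → dest b ≡ l → LeadingInto i bs → LeadingInto (suc i) (b ∷ bs)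

  Pending : ℕ → Command n k → Set
  Pending i c = NotAt c × LeadingInto i (branches c)

  all-into⇒LeadingInto : ∀ {bs} → All (λ b → dest b ≡ l) bs → LeadingInto (length bs) bs
  all-into⇒LeadingInto []         = [] []
  all-into⇒LeadingInto (db ∷ dbs) = db ∷ all-into⇒LeadingInto dbs

  LeadingInto-++ : ∀ {i bs bs′} → LeadingInto i bs → All (λ b → dest b ≢ l) bs′ →
                   LeadingInto i (bs ++ bs′)
  LeadingInto-++ ([] ok)  ok′ = [] (AllP.++⁺ ok ok′)
  LeadingInto-++ (db ∷ p) ok′ = db ∷ LeadingInto-++ p ok′

  Pending-elimCmd : ∀ {i bs} w b → NotAt w → LeadingInto i bs →
                    ∀ {d} → NoBranchInto d → Pending i (elimCmd w bs b d)
  Pending-elimCmd _ _ w-away p d-ok = w-away , LeadingInto-++ p (AllP.map⁺ d-ok)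

  Pending-zero⇒NoBranchInto : ∀ {c} → Pending zero c → NoBranchInto c
  Pending-zero⇒NoBranchInto (_ , [] ok) = ok

  cmdsAt-++-NotAt : ∀ xs {ys} → All NotAt ys → cmdsAt l (xs ++ ys) ≡ cmdsAt l xs
  cmdsAt-++-NotAt xs {ys} ys-away = begin
    cmdsAt l (xs ++ ys)        ≡⟨ LP.filter-++ (λ c → src c ≟ l) xs ys ⟩
    cmdsAt l xs ++ cmdsAt l ys ≡⟨ cong (cmdsAt l xs ++_) (LP.filter-none (λ c → src c ≟ l) ys-away) ⟩
    cmdsAt l xs ++ []          ≡⟨ LP.++-identityʳ (cmdsAt l xs) ⟩
    cmdsAt l xs                ∎

  All⇒NoTransInto : ∀ {cs} → All NoBranchInto cs → NoTransInto l cs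
  All⇒NoTransInto ok c c∈cs b b∈c = All.lookup (All.lookup ok c∈cs) b∈c

  NoTransInto⇒NoBranchInto : ∀ {cs c} → NoTransInto l cs → c ∈ cs → NoBranchInto c
  NoTransInto⇒NoBranchInto none c∈cs = All.tabulate (none _ c∈cs _)

  ElimLoc⇒NoTransInto : ∀ {cs cs′ : List (Command n k)} → ElimLoc l cs cs′ → NoTransInto l cs′
  ElimLoc⇒NoTransInto (done none) = none
  ElimLoc⇒NoTransInto (step _ run) = ElimLoc⇒NoTransInto run

  Star⇒ElimLoc : ∀ {cs cs′ : List (Command n k)} → Star (ElimStep l) cs cs′ → NoTransInto l cs′ →
                 ElimLoc l cs cs′
  Star⇒ElimLoc ε          none = done none
  Star⇒ElimLoc (s ◅ steps) none = step s (Star⇒ElimLoc steps none)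

  eliminated : ∀ {cs cs′ : List (Command n k)} → ElimStep l cs cs′ → Command n k
  eliminated (elim _ _ γ _ _ _ _ _) = γ

  ElimStep-source⁻ : ∀ {cs cs′ c} (st : ElimStep l cs cs′) → c ∈ cs → c ≡ eliminated st ⊎ c ∈ cs′
  ElimStep-source⁻ (elim cs₁ _ _ _ _ _ _ _) = ∈-remove-++ cs₁ _

  ElimStep-keeps : ∀ {cs cs′ c} → ElimStep l cs cs′ → c ∈ cs → NoBranchInto c → c ∈ cs′
  ElimStep-keeps st@(elim _ _ _ bs₁ b _ eq db) c∈cs c-ok with ElimStep-source⁻ st c∈cs
  ... | inj₁ refl  = ⊥-elim (All.lookup c-ok (subst (b ∈_) (sym eq) (∈-insert bs₁)) db)
  ... | inj₂ c∈cs′ = c∈cs′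

  module _ {pre : List (Command n k)} (pre-done : All NoBranchInto pre) where

    pre-at-l-done : All NoBranchInto (cmdsAt l pre)
    pre-at-l-done = AllP.filter⁺ (λ c → src c ≟ l) pre-done

    eliminate-first : ∀ {s g b bs} rest → NotAt (cmd s g (b ∷ bs)) → All NotAt rest → dest b ≡ l →
                      ElimStep l (pre ++ cmd s g (b ∷ bs) ∷ rest)
                                 (pre ++ rest ++ map (elimCmd (cmd s g (b ∷ bs)) bs b) (cmdsAt l pre))
    eliminate-first {s} {g} {b} {bs} rest w-away rest-away db =
      subst (λ ds → ElimStep l (pre ++ w ∷ rest) (pre ++ rest ++ map (elimCmd w bs b) ds))
            (cmdsAt-++-NotAt pre (w-away ∷ rest-away))
            (elim pre rest w [] b bs refl db)
      where
      w : Command n k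
      w = cmd s g (b ∷ bs)

    -- Elimination appends the new commands at the end of the list, so pending commands are
    -- processed in rounds, each removing the first branch into l of every pending command.
    elimination-round : ∀ {i} ws acc → All (Pending (suc i)) ws → All (Pending i) acc →
            Σ[ acc′ ∈ List (Command n k) ]
              (Star (ElimStep l) (pre ++ ws ++ acc) (pre ++ acc′) × All (Pending i) acc′)
    elimination-round [] acc [] acc-p = acc , ε , acc-p
    elimination-round {i} (w@(cmd s g _) ∷ ws) acc ((w-away , _∷_ {b = b} {bs} db p) ∷ ws-p) acc-p =
      let acc′ , steps , acc′-p = elimination-round ws (acc ++ new) ws-p (AllP.++⁺ acc-p new-p)
      in acc′ , first ◅ steps , acc′-p
      where
      new : List (Command n k)
      new = map (elimCmd w bs b) (cmdsAt l pre)
      new-p : All (Pending i) new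
      new-p = AllP.map⁺ {f = elimCmd w bs b}
                (All.map (λ {d} → Pending-elimCmd w b w-away p {d}) pre-at-l-done)
      rest-away : All NotAt (ws ++ acc)
      rest-away = AllP.++⁺ (All.map proj₁ ws-p) (All.map proj₁ acc-p)
      first : ElimStep l (pre ++ w ∷ ws ++ acc) (pre ++ ws ++ acc ++ new)
      first = subst (λ zs → ElimStep l _ (pre ++ zs)) (LP.++-assoc ws acc new)
                    (eliminate-first (ws ++ acc) w-away rest-away db)

    drain : ∀ i ws → All (Pending i) ws →
            Σ[ ws′ ∈ List (Command n k) ]
              (Star (ElimStep l) (pre ++ ws) (pre ++ ws′) × All (Pending zero) ws′)
    drain zero    ws ws-p = ws , ε , ws-p
    drain (suc i) ws ws-p =
      let acc , steps₁ , acc-p = elimination-round ws [] ws-p []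
          ws′ , steps₂ , ws′-p = drain i acc acc-p
          steps₁′ = subst (λ zs → Star (ElimStep l) (pre ++ zs) (pre ++ acc)) (LP.++-identityʳ ws) steps₁
      in ws′ , steps₁′ ◅◅ steps₂ , ws′-p

    ElimLoc-exists : ∀ {i} ws → All (Pending i) ws →
                     Σ[ cs′ ∈ List (Command n k) ] ElimLoc l (pre ++ ws) cs′
    ElimLoc-exists {i} ws ws-p =
      let ws′ , steps , ws′-p = drain i ws ws-p
          ws′-done = All.map (λ {c} → Pending-zero⇒NoBranchInto {c}) ws′-p
      in pre ++ ws′ , Star⇒ElimLoc steps (All⇒NoTransInto (AllP.++⁺ pre-done ws′-done))

target-dest : ∀ {n k} D (b : Branch n k) ν {l ν′} → target D b ν ≡ just (l , ν′) → dest b ≡ l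
target-dest D b ν eq with inDom D (upd b ν)
... | true  = ProdP.,-injectiveˡ (MaybeP.just-injective eq)
... | false with () ← eq

inDom-∷[] : ∀ {x : ℤ} {xs} → x ∈ xs → inDom (xs Vec.∷ Vec.[]) (x Vec.∷ Vec.[]) ≡ true
inDom-∷[] {x} {xs} x∈xs =
  trans (BP.∧-identityʳ (any equals-x xs)) (Equivalence.to BP.T-≡ (AnyP.any⁺ equals-x (Any.map T-equals x∈xs)))
  where
  equals-x : ℤ → Bool
  equals-x w = does (x ℤ.≟ w)
  T-equals : ∀ {w} → x ≡ w → T (equals-x w)
  T-equals refl = Equivalence.from BP.T-≡ (dec-true (x ℤ.≟ x) refl)

l₀ l₁ : Fin 4
l₀ = zero
l₁ = suc zero

exitLoc : Fin 2 → Fin 4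
exitLoc i = suc (suc i)

exitLoc≢l₁ : ∀ i → exitLoc i ≢ l₁
exitLoc≢l₁ _ ()

exit : Fin 2 → Command 4 1
exit i = cmd l₁ (λ _ → true) (br 1ℚ (λ ν → ν) (exitLoc i) ∷ [])

exit-NoBranchInto : ∀ i → NoBranchInto {l = l₁} (exit i)
exit-NoBranchInto i = exitLoc≢l₁ i ∷ []

exit-WF : ∀ i → WFCommand (exit i)
exit-WF i = (λ { _ (here refl) → ℚP.<⇒≤ (ℚP.positive⁻¹ 1ℚ) }) , refl

-- The fan has m + 1 transitions into l₁, indexed by Fin (suc m).
module Blowup (m : ℕ) where

  Choice : Set
  Choice = Vec (Fin 2) (suc m)

  value : Fin (suc m) → Valuation 1
  value j = ℤ.+ toℕ j Vec.∷ Vec.[]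

  ν₀ : Valuation 1
  ν₀ = value zero

  domain : Vec (List ℤ) 1
  domain = tabulate {n = suc m} (ℤ.+_ ∘ toℕ) Vec.∷ Vec.[]

  incoming : Fin (suc m) → Branch 4 1
  incoming j = br (halves m j) (λ _ → value j) l₁

  fan : Command 4 1
  fan = cmd l₀ (λ _ → true) (tabulate incoming)

  exits : List (Command 4 1)
  exits = exit zero ∷ exit (suc zero) ∷ []

  program : PCFP 4 1
  program = record { dom = domain ; cmds = exits ++ fan ∷ [] ; initLoc = l₀ ; initVal = ν₀ }

  outcome : Fin (suc m) → Fin 2 → State 4 1
  outcome j i = just (exitLoc i , value j)

  value-injective : ∀ {j j′} → value j ≡ value j′ → j ≡ j′
  value-injective eq = FinP.toℕ-injective (ℤP.+-injective (VecP.∷-injectiveˡ eq))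

  outcome-injective : ∀ {j j′ i i′} → outcome j i ≡ outcome j′ i′ → j ≡ j′ × i ≡ i′
  outcome-injective eq with loc-eq , val-eq ← ProdP.,-injective (MaybeP.just-injective eq) =
    value-injective val-eq , FinP.suc-injective (FinP.suc-injective loc-eq)

  value-inDom : ∀ j → inDom domain (value j) ≡ true
  value-inDom j = inDom-∷[] (∈-tabulate⁺ {f = ℤ.+_ ∘ toℕ} j)

  incoming-into : All (λ b → dest b ≡ l₁) (tabulate incoming)
  incoming-into = AllP.tabulate⁺ {f = incoming} (λ _ → refl)

  incoming-nonneg : All (λ b → 0ℚ ℚ.≤ prob b) (tabulate incoming)
  incoming-nonneg = AllP.tabulate⁺ {f = incoming} (λ j → ℚP.<⇒≤ (halves-pos m j))

  program-WF : WF program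
  program-WF = (λ _ → All.lookup {P = WFCommand} (exit-WF zero ∷ exit-WF (suc zero) ∷ fan-WF ∷ [])) ,
               refl
    where
    fan-WF : WFCommand fan
    fan-WF = (λ _ → All.lookup incoming-nonneg) ,
             trans (cong sumℚ (LP.map-tabulate incoming prob)) (halves-sum m)

  program-noSelfLoop : NoSelfLoop program l₁
  program-noSelfLoop _ (here refl)                 _  _ = All.lookup (exit-NoBranchInto zero)
  program-noSelfLoop _ (there (here refl))         _  _ = All.lookup (exit-NoBranchInto (suc zero))
  program-noSelfLoop _ (there (there (here refl))) ()

  fan-multiplicity : HasTransMult program l₀ l₁ (suc m)
  fan-multiplicity =
    fan , there (there (here refl)) , refl , (incoming zero , here refl , refl) ,
    trans (cong length (LP.filter-all (λ b → dest b ≟ l₁) incoming-into)) (LP.length-tabulate incoming)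

  elimination-terminates : Σ[ cs′ ∈ List (Command 4 1) ] ElimLoc l₁ (cmds program) cs′
  elimination-terminates =
    ElimLoc-exists (exit-NoBranchInto zero ∷ exit-NoBranchInto (suc zero) ∷ [])
                   (fan ∷ []) (((λ ()) , all-into⇒LeadingInto incoming-into) ∷ [])

  data Resolves (S : Choice) (j : Fin (suc m)) (b : Branch 4 1) : Set where
    still-incoming : b ≡ incoming j → Resolves S j b
    redirected     : target domain b ν₀ ≡ outcome j (lookup S j) → Resolves S j b

  resolves-incoming : ∀ {S j j′} → Resolves S j′ (incoming j) → j′ ≡ j
  resolves-incoming         (still-incoming eq) = sym (value-injective (cong (λ b → upd b ν₀) eq))
  resolves-incoming {j = j} (redirected t)      =
    ⊥-elim (exitLoc≢l₁ _ (sym (target-dest domain (incoming j) ν₀ t)))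

  resolves-into-l₁ : ∀ {S j b} → Resolves S j b → dest b ≡ l₁ → b ≡ incoming j
  resolves-into-l₁         (still-incoming eq) _  = eq
  resolves-into-l₁ {b = b} (redirected t)      db =
    ⊥-elim (exitLoc≢l₁ _ (trans (sym (target-dest domain b ν₀ t)) db))

  resolves-outside-l₁ : ∀ {S j b} → Resolves S j b → dest b ≢ l₁ →
                        target domain b ν₀ ≡ outcome j (lookup S j)
  resolves-outside-l₁ (still-incoming refl) b-out = ⊥-elim (b-out refl)
  resolves-outside-l₁ (redirected t)         _     = t

  -- c is the fan with some of its transitions into l₁, say the j-th, already redirected
  -- through exit (lookup S j); the value x = j keeps track of which transition it was.
  record Realizes (S : Choice) (c : Command 4 1) : Set where
    field
      at-l₀    : src c ≡ l₀
      enabled  : guard c ν₀ ≡ true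
      nonneg   : All (λ b → 0ℚ ℚ.≤ prob b) (branches c)
      resolved : All (λ b → ∃[ j ] Resolves S j b) (branches c)
      covered  : ∀ j → Any (λ b → Resolves S j b × 0ℚ ℚ.< prob b) (branches c)
  open Realizes

  fan-realizes : ∀ S → Realizes S fan
  fan-realizes S = record
    { at-l₀    = refl
    ; enabled  = refl
    ; nonneg   = incoming-nonneg
    ; resolved = AllP.tabulate⁺ {f = incoming} (λ j → j , still-incoming refl)
    ; covered  = λ j → AnyP.tabulate⁺ {f = incoming} j (still-incoming refl , halves-pos m j)
    }

  Realizes-elim : ∀ {S s g} bs₁ j bs₂ → Realizes S (cmd s g (bs₁ ++ incoming j ∷ bs₂)) →
                  Realizes S (elimCmd (cmd s g (bs₁ ++ incoming j ∷ bs₂)) (bs₁ ++ bs₂)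
                                      (incoming j) (exit (lookup S j)))
  Realizes-elim {S} bs₁ j bs₂ r = record
    { at-l₀    = at-l₀ r
    ; enabled  = trans (BP.∧-identityʳ _) (enabled r)
    ; nonneg   = AllP.++⁺ (All-remove bs₁ (nonneg r)) (ℚP.<⇒≤ shortcut-pos ∷ [])
    ; resolved = AllP.++⁺ (All-remove bs₁ (resolved r)) ((j , redirected shortcut-target) ∷ [])
    ; covered  = covered′
    }
    where
    shortcut : Branch 4 1
    shortcut = br (halves m j * 1ℚ) ((λ _ → value j) ⨾ (λ ν → ν)) (exitLoc (lookup S j))
    shortcut-target : target domain shortcut ν₀ ≡ outcome j (lookup S j)
    shortcut-target rewrite value-inDom j = refl
    shortcut-pos : 0ℚ ℚ.< halves m j * 1ℚ
    shortcut-pos = subst (0ℚ ℚ.<_) (sym (ℚP.*-identityʳ _)) (halves-pos m j)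
    covered′ : ∀ j′ → Any (λ b → Resolves S j′ b × 0ℚ ℚ.< prob b) ((bs₁ ++ bs₂) ++ shortcut ∷ [])
    covered′ j′ with Any-remove bs₁ (covered r j′)
    ... | inj₂ elsewhere = AnyP.++⁺ˡ elsewhere
    ... | inj₁ (res , _) with refl ← resolves-incoming res =
      AnyP.++⁺ʳ (bs₁ ++ bs₂) (here (redirected shortcut-target , shortcut-pos))

  Realization : Choice → List (Command 4 1) → Set
  Realization S cs = ∃[ c ] (c ∈ cs × Realizes S c)

  realization-step : ∀ {S cs cs′} → ElimStep l₁ cs cs′ → (∀ i → exit i ∈ cs) →
                     Realization S cs → Realization S cs′
  realization-step {S} st@(elim cs₁ cs₂ (cmd s g _) bs₁ b bs₂ refl db) exits∈cs (c , c∈cs , r)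
    with ElimStep-source⁻ st c∈cs
  ... | inj₂ c∈cs′ = c , c∈cs′ , r
  ... | inj₁ refl with j , res ← All.lookup (resolved r) (∈-insert bs₁)
                  with refl ← resolves-into-l₁ res db =
    _ , ∈-++⁺ʳ cs₁ (∈-++⁺ʳ cs₂ (∈-map⁺ _ exit∈at-l₁)) , Realizes-elim bs₁ j bs₂ r
    where
    exit∈at-l₁ : exit (lookup S j) ∈ cmdsAt l₁ (cs₁ ++ _ ∷ cs₂)
    exit∈at-l₁ = ∈-filter⁺ (λ c → src c ≟ l₁) (exits∈cs (lookup S j)) refl

  record Invariant (cs : List (Command 4 1)) : Set where
    field
      exits-kept  : ∀ i → exit i ∈ cs
      realization : ∀ S → Realization S cs
  open Invariant

  Invariant-program : Invariant (cmds program)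
  Invariant-program = record
    { exits-kept  = λ { zero → here refl ; (suc zero) → there (here refl) }
    ; realization = λ S → fan , there (there (here refl)) , fan-realizes S
    }

  Invariant-ElimLoc : ∀ {cs cs′} → ElimLoc l₁ cs cs′ → Invariant cs → Invariant cs′
  Invariant-ElimLoc (done _)       inv = inv
  Invariant-ElimLoc (step st run) inv = Invariant-ElimLoc run record
    { exits-kept  = λ i → ElimStep-keeps st (exits-kept inv i) (exit-NoBranchInto i)
    ; realization = λ S → realization-step st (exits-kept inv) (realization inv S)
    }

  weight : State 4 1 → Branch 4 1 → ℚ
  weight s b = if does (target domain b ν₀ ≟S s) then prob b else 0ℚ

  weight-nonneg : ∀ s {b} → 0ℚ ℚ.≤ prob b → 0ℚ ℚ.≤ weight s b
  weight-nonneg s {b} p≥0 with target domain b ν₀ ≟S s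
  ... | yes _ = p≥0
  ... | no  _ = ℚP.≤-refl

  weight-hit : ∀ {s} b → target domain b ν₀ ≡ s → weight s b ≡ prob b
  weight-hit {s} b hit with target domain b ν₀ ≟S s
  ... | yes _    = refl
  ... | no  miss = ⊥-elim (miss hit)

  weight-miss : ∀ {s} b → target domain b ν₀ ≢ s → weight s b ≡ 0ℚ
  weight-miss {s} b miss with target domain b ν₀ ≟S s
  ... | yes hit = ⊥-elim (miss hit)
  ... | no  _   = refl

  module _ {S c} (r : Realizes S c) (c-done : NoBranchInto {l = l₁} c) where

    dist-chosen-pos : ∀ j → 0ℚ ℚ.< dist domain c ν₀ (outcome j (lookup S j))
    dist-chosen-pos j with b , b∈c , res , p>0 ← find (covered r j) =
      sumℚ-pos (AllP.map⁺ {f = weight chosen} (All.map (λ {b} → weight-nonneg chosen {b}) (nonneg r)))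
               (∈-map⁺ (weight chosen) b∈c)
               (subst (0ℚ ℚ.<_) (sym (weight-hit b hits-chosen)) p>0)
      where
      hits-chosen : target domain b ν₀ ≡ outcome j (lookup S j)
      hits-chosen = resolves-outside-l₁ res (All.lookup c-done b∈c)
      chosen : State 4 1
      chosen = outcome j (lookup S j)

    dist-unchosen-zero : ∀ j i → i ≢ lookup S j → dist domain c ν₀ (outcome j i) ≡ 0ℚ
    dist-unchosen-zero j i i≢Sj = sumℚ-zero (AllP.map⁺ (All.zipWith misses (resolved r , c-done)))
      where
      misses : ∀ {b} → (∃[ j′ ] Resolves S j′ b) × dest b ≢ l₁ → weight (outcome j i) b ≡ 0ℚ
      misses {b} ((j′ , res) , b-out) = weight-miss b hits-impossible
        where
        hits-impossible : target domain b ν₀ ≢ outcome j i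
        hits-impossible hit
          with refl , refl ← outcome-injective (trans (sym (resolves-outside-l₁ res b-out)) hit) = i≢Sj refl

  same-dist⇒same-choice : ∀ {S T c c′} → Realizes S c → Realizes T c′ →
                          NoBranchInto {l = l₁} c → NoBranchInto {l = l₁} c′ →
                          (∀ s → dist domain c ν₀ s ≡ dist domain c′ ν₀ s) → S ≡ T
  same-dist⇒same-choice {S} {T} {c} rS rT c-done c′-done same = Pointwise-≡⇒≡ (ext agree)
    where
    agree : ∀ j → lookup S j ≡ lookup T j
    agree j with lookup S j ≟ lookup T j
    ... | yes Sj≡Tj = Sj≡Tj
    ... | no  Sj≢Tj = ⊥-elim (ℚP.<-irrefl refl (subst (0ℚ ℚ.<_) unchosen-by-T (dist-chosen-pos rS c-done j)))
      where
      unchosen-by-T : dist domain c ν₀ (outcome j (lookup S j)) ≡ 0ℚ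
      unchosen-by-T = trans (same _) (dist-unchosen-zero rT c′-done j _ Sj≢Tj)

  record Counterpart (P̃ : PCFP 4 1) (S : Choice) : Set where
    field
      realizer      : Command 4 1
      realizes      : Realizes S realizer
      realizer-done : NoBranchInto {l = l₁} realizer
      command       : Command 4 1
      command-at-l₀ : command ∈ cmdsAt l₀ (cmds P̃)
      same-dist     : ∀ s → dist domain realizer ν₀ s ≡ dist (dom P̃) command ν₀ s
  open Counterpart

  counterpart : ∀ {cs′} → ElimLoc l₁ (cmds program) cs′ → (P̃ : PCFP 4 1) →
                ActionsIncluded (withCmds program cs′) P̃ → ∀ S → Counterpart P̃ S
  counterpart run P̃ simulate S with realization (Invariant-ElimLoc run Invariant-program) S
  ... | c , c∈cs′ , r with simulate l₀ ν₀ refl c c∈cs′ (at-l₀ r) (enabled r)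
  ...   | c̃ , c̃∈P̃ , c̃-at , _ , same = record
    { realizer      = c
    ; realizes      = r
    ; realizer-done = NoTransInto⇒NoBranchInto (ElimLoc⇒NoTransInto run) c∈cs′
    ; command       = c̃
    ; command-at-l₀ = ∈-filter⁺ (λ c → src c ≟ l₀) c̃∈P̃ c̃-at
    ; same-dist     = same
    }

  command-injective : ∀ {P̃} (cp : ∀ S → Counterpart P̃ S) → Injective _≡_ _≡_ (command ∘ cp)
  command-injective {P̃} cp {S} {T} c̃S≡c̃T =
    same-dist⇒same-choice (realizes (cp S)) (realizes (cp T)) (realizer-done (cp S)) (realizer-done (cp T))
      λ s → begin
        dist domain (realizer (cp S)) ν₀ s ≡⟨ same-dist (cp S) s ⟩
        dist (dom P̃) (command (cp S)) ν₀ s ≡⟨ cong (λ c̃ → dist (dom P̃) c̃ ν₀ s) c̃S≡c̃T ⟩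
        dist (dom P̃) (command (cp T)) ν₀ s ≡⟨ same-dist (cp T) s ⟨
        dist domain (realizer (cp T)) ν₀ s ∎

  commands-at-l₀ : ∀ {cs′} → ElimLoc l₁ (cmds program) cs′ → (P̃ : PCFP 4 1) →
                   SameMDP P̃ (withCmds program cs′) → 2 ^ suc m ≤ length (cmdsAt l₀ (cmds P̃))
  commands-at-l₀ run P̃ (_ , _ , _ , _ , simulate) =
    injective⇒^≤length (command ∘ cp) (command-injective cp) (command-at-l₀ ∘ cp)
    where
    cp : ∀ S → Counterpart P̃ S
    cp = counterpart run P̃ simulate

proposition1 : (m : ℕ) → m ≥ 1 →
    Σ[ n ∈ ℕ ] Σ[ k ∈ ℕ ] Σ[ P ∈ PCFP n k ] Σ[ l ∈ Fin n ] Σ[ l' ∈ Fin n ]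
      ( WF P × NoSelfLoop P l × l' ≢ l × HasTransMult P l' l m
      × (Σ[ cs' ∈ List (Command n k) ] ElimLoc l (cmds P) cs')
      × ((cs' : List (Command n k)) → ElimLoc l (cmds P) cs' →
         (P̃ : PCFP n k) → WF P̃ → Unique (cmds P̃) → NoTransInto l (cmds P̃) →
         SameMDP P̃ (withCmds P cs') →
         2 ^ m ≤ length (cmdsAt l' (cmds P̃))) )
proposition1 zero    ()
proposition1 (suc m) _ =
  4 , 1 , program , l₁ , l₀ , program-WF , program-noSelfLoop , (λ ()) , fan-multiplicity ,
  elimination-terminates , λ _ run P̃ _ _ _ → commands-at-l₀ run P̃
  where open Blowup m
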